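{- Let $T$ be a finite union-closed family of sets with $\emptyset\notin T$ and height number $H(T)=2$. Then every element of $\bigcup_{A\in T}A$ belongs to at least $|T|-1$ sets of $T$, where $|T|$ denotes the number of sets in $T$.
   Context: A union-closed family is a finite family of finite sets closed under pairwise union. Height decomposition of a union-closed family $\mathcal{G}$: $\pi_1$ is the set of inclusion-minimal members of $\mathcal{G}$; inductively, while $\mathcal{G}\setminus(\pi_1\cup\dots\cup\pi_{i-1})\neq\emptyset$, $\pi_i$ is the set of inclusion-minimal members of $\mathcal{G}\setminus(\pi_1\cup\dots\cup\pi_{i-1})$; the number of steps until $\mathcal{G}$ is exhausted is the height number $H(\mathcal{G})$. -}

module Defs where

open import Data.Nat using (ℕ; zero; suc)
open import Data.List using (List; []; _∷_; filter; length)
open import Data.List.Membership.Propositional using (_∈_)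
open import Data.List.Relation.Unary.Any using (any?)
open import Data.List.Relation.Unary.Unique.Propositional using (Unique)
open import Data.Fin.Subset using (Subset; _∪_; _⊂_) renaming (_∈_ to _∈ₛ_; ⊥ to ∅)
open import Data.Fin.Subset.Properties using (_⊂?_; _∈?_)
open import Data.Fin using (Fin)
open import Data.Product using (∃; _×_)
open import Relation.Nullary using (¬_)

record Family (n : ℕ) : Set where
  constructor family
  field
    members : List (Subset n)
    distinct : Unique members
open Family public

card : ∀ {n} → Family n → ℕ
card T = length (members T)

UnionClosed : ∀ {n} → Family n → Set
UnionClosed T = ∀ {A B} → A ∈ members T → B ∈ members T → (A ∪ B) ∈ members T

-- Members of G that are NOT inclusion-minimal in G (i.e. have a proper
-- subset in G).  Removing the minimal members = keeping these.
removeMinimal : ∀ {n} → List (Subset n) → List (Subset n)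
removeMinimal G = filter (λ A → any? (λ B → B ⊂? A) G) G

-- Number of height-decomposition steps until the list is exhausted,
-- with a fuel argument (fuel = |G| always suffices since each step on
-- a nonempty finite family removes at least one minimal member).
heightAux : ∀ {n} → ℕ → List (Subset n) → ℕ
heightAux zero G = zero
heightAux (suc k) [] = zero
heightAux (suc k) (A ∷ G) = suc (heightAux k (removeMinimal (A ∷ G)))

H : ∀ {n} → Family n → ℕ
H T = heightAux (length (members T)) (members T)

degree : ∀ {n} → Fin n → Family n → ℕ
degree x T = length (filter (x ∈?_) (members T))

InUnion : ∀ {n} → Fin n → Family n → Set
InUnion x T = ∃ λ A → A ∈ members T × x ∈ₛ A

-- A member Q of T that misses x is inclusion-minimal: if P ⊂ Q, then with C ∈ T
-- containing x we get the chain P ⊂ Q ⊂ Q ∪ C in T, which survives two rounds of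
-- removing minimal members and so forces H(T) ≥ 3.  If A, B ∈ T both miss x, then
-- so does A ∪ B; being minimal, A ∪ B equals both A and B.  Hence at most one
-- member of T misses x.
module Submission where

open import Defs
open import Data.Nat using (ℕ; zero; suc; _≤_; _∸_; z≤n; s≤s)
open import Data.Nat.Properties using (≤-reflexive; ≤⇒≯; m≤n⇒m≤1+n)
open import Data.Fin using (Fin)
open import Data.List using (List; []; _∷_; filter; length)
open import Data.List.Properties using (filter-all)
open import Data.List.Membership.Propositional using (_∈_; _∉_; lose)
open import Data.List.Membership.Propositional.Properties using (∈-filter⁺)
open import Data.List.Relation.Unary.Any using (here; there; any?)
import Data.List.Relation.Unary.All as All
open import Data.List.Relation.Unary.AllPairs using (_∷_)
open import Data.List.Relation.Unary.Unique.Propositional using (Unique)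
open import Data.Fin.Subset using (Subset; _∪_; _⊆_; _⊂_) renaming (⊥ to ∅; _∈_ to _∈ₛ_; _∉_ to _∉ₛ_)
open import Data.Fin.Subset.Properties
  using (_⊂?_; _∈?_; p⊆p∪q; q⊆p∪q; x∈p∪q⁻; x∈p∪q⁺; ⊆-antisym; ⊂-irref; ⊂-trans)
open import Data.Product using (_,_)
open import Data.Sum using (inj₂; [_,_]′)
open import Relation.Nullary using (¬_; yes; no; contradiction)
open import Relation.Unary using (Decidable)
open import Relation.Binary.PropositionalEquality using (_≡_; _≢_; refl; sym; trans; cong)
open import Function using (_∘_)

2≤length : ∀ {A : Set} {a b : A} {xs : List A} → a ∈ xs → b ∈ xs → a ≢ b → 2 ≤ length xs
2≤length (here refl) (here refl) a≢b = contradiction refl a≢b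
2≤length {xs = _ ∷ _ ∷ _} (here refl) (there _) _ = s≤s (s≤s z≤n)
2≤length {xs = _ ∷ _ ∷ _} (there _)   _         _ = s≤s (s≤s z≤n)
2≤length {xs = _ ∷ []}    (here refl) (there ()) _
2≤length {xs = _ ∷ []}    (there ())  _          _

3≤length : ∀ {A : Set} {a b c : A} {xs : List A} → a ∈ xs → b ∈ xs → c ∈ xs →
           a ≢ b → a ≢ c → b ≢ c → 3 ≤ length xs
3≤length (here refl) (here refl) _           a≢b _   _   = contradiction refl a≢b
3≤length (here refl) _           (here refl) _   a≢c _   = contradiction refl a≢c
3≤length (there _)   (here refl) (here refl) _   _   b≢c = contradiction refl b≢c
3≤length (here refl) (there b)   (there c)   _   _   b≢c = s≤s (2≤length b c b≢c)
3≤length (there a)   (here refl) (there c)   _   a≢c _   = s≤s (2≤length a c a≢c)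
3≤length (there a)   (there b)   (here refl) a≢b _   _   = s≤s (2≤length a b a≢b)
3≤length (there a)   (there b)   (there c)   a≢b a≢c b≢c = m≤n⇒m≤1+n (3≤length a b c a≢b a≢c b≢c)

-- Duplicates of the one failing element would each be dropped, hence Unique.
module _ {A : Set} {P : A → Set} (P? : Decidable P) where

  length-filter-∸1 : ∀ xs → Unique xs → (∀ {a b} → a ∈ xs → b ∈ xs → ¬ P a → ¬ P b → a ≡ b) →
                     length xs ∸ 1 ≤ length (filter P? xs)
  length-filter-∸1 []       _          _      = z≤n
  length-filter-∸1 (a ∷ ys) (a∉ys ∷ u) unique with P? a
  ... | yes _ = pred-≤ (length-filter-∸1 ys u λ b c → unique (there b) (there c))
    where
    pred-≤ : ∀ {m k} → m ∸ 1 ≤ k → m ≤ suc k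
    pred-≤ {zero}  _ = z≤n
    pred-≤ {suc _} p = s≤s p
  ... | no ¬Pa = ≤-reflexive (sym (cong length (filter-all P? (All.tabulate satisfies))))
    where
    satisfies : ∀ {b} → b ∈ ys → P b
    satisfies {b} b∈ys with P? b
    ... | yes Pb = Pb
    ... | no ¬Pb = contradiction (sym (unique (there b∈ys) (here refl) ¬Pb ¬Pa)) (All.lookup a∉ys b∈ys)

p⊆q∧p⊄q⇒p≡q : ∀ {n} {p q : Subset n} → p ⊆ q → ¬ p ⊂ q → p ≡ q
p⊆q∧p⊄q⇒p≡q {p = p} p⊆q p⊄q = ⊆-antisym p⊆q q⊆p
  where
  q⊆p : _ ⊆ p
  q⊆p {y} y∈q with y ∈? p
  ... | yes y∈p = y∈p
  ... | no  y∉p = contradiction ((λ {z} → p⊆q {z}) , y , y∈q , y∉p) p⊄q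

removeMinimal⁺ : ∀ {n} {G : List (Subset n)} {A B} → A ∈ G → B ∈ G → B ⊂ A → A ∈ removeMinimal G
removeMinimal⁺ {G = G} A∈G B∈G B⊂A = ∈-filter⁺ (λ A → any? (_⊂? A) G) A∈G (lose B∈G B⊂A)

heightAux-step : ∀ {n} {m} k {G : List (Subset n)} {A} → A ∈ G →
                 m ≤ heightAux k (removeMinimal G) → suc m ≤ heightAux (suc k) G
heightAux-step k {_ ∷ _} _ = s≤s

⊂-chain⇒3≤heightAux : ∀ {n} {G : List (Subset n)} {P Q S} f → 3 ≤ f →
                      P ∈ G → Q ∈ G → S ∈ G → P ⊂ Q → Q ⊂ S → 3 ≤ heightAux f G
⊂-chain⇒3≤heightAux (suc (suc (suc k))) (s≤s (s≤s (s≤s _))) P∈G Q∈G S∈G P⊂Q Q⊂S =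
  heightAux-step _ Q∈G (heightAux-step _ Q∈rmG (heightAux-step k S∈rm²G z≤n))
  where
  Q∈rmG = removeMinimal⁺ Q∈G P∈G P⊂Q
  S∈rm²G = removeMinimal⁺ (removeMinimal⁺ S∈G Q∈G Q⊂S) Q∈rmG Q⊂S

⊂-chain⇒3≤H : ∀ {n} (T : Family n) {P Q S} → P ∈ members T → Q ∈ members T → S ∈ members T →
              P ⊂ Q → Q ⊂ S → 3 ≤ H T
⊂-chain⇒3≤H T P∈ Q∈ S∈ P⊂Q Q⊂S =
  ⊂-chain⇒3≤heightAux (card T) (3≤length P∈ Q∈ S∈ (ne P⊂Q) (ne (⊂-trans P⊂Q Q⊂S)) (ne Q⊂S))
                      P∈ Q∈ S∈ P⊂Q Q⊂S
  where
  ne : ∀ {X Y} → X ⊂ Y → X ≢ Y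
  ne X⊂Y X≡Y = ⊂-irref X≡Y X⊂Y

module _ {n} (T : Family n) (closed : UnionClosed T) (H≤2 : H T ≤ 2)
         {x : Fin n} {C} (C∈T : C ∈ members T) (x∈C : x ∈ₛ C) where

  ∉-member-minimal : ∀ {P Q} → P ∈ members T → Q ∈ members T → x ∉ₛ Q → ¬ P ⊂ Q
  ∉-member-minimal {Q = Q} P∈T Q∈T x∉Q P⊂Q =
    ≤⇒≯ H≤2 (⊂-chain⇒3≤H T P∈T Q∈T (closed Q∈T C∈T) P⊂Q Q⊂Q∪C)
    where
    Q⊂Q∪C : Q ⊂ Q ∪ C
    Q⊂Q∪C = p⊆p∪q C , x , x∈p∪q⁺ (inj₂ x∈C) , x∉Q

  ∉-members-equal : ∀ {A B} → A ∈ members T → B ∈ members T → x ∉ₛ A → x ∉ₛ B → A ≡ B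
  ∉-members-equal {A} {B} A∈T B∈T x∉A x∉B = trans A≡A∪B (sym B≡A∪B)
    where
    A∪B∈T = closed A∈T B∈T
    x∉A∪B : x ∉ₛ A ∪ B
    x∉A∪B = [ x∉A , x∉B ]′ ∘ x∈p∪q⁻ A B
    A≡A∪B = p⊆q∧p⊄q⇒p≡q (p⊆p∪q B) (∉-member-minimal A∈T A∪B∈T x∉A∪B)
    B≡A∪B = p⊆q∧p⊄q⇒p≡q (q⊆p∪q A B) (∉-member-minimal B∈T A∪B∈T x∉A∪B)

corollary3p2p1 : ∀ {n : ℕ} (T : Family n) → UnionClosed T → ∅ ∉ members T → H T ≡ 2 →
    ∀ (x : Fin n) → InUnion x T → card T ∸ 1 ≤ degree x T
corollary3p2p1 T closed _ H≡2 x (C , C∈T , x∈C) =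
  length-filter-∸1 (x ∈?_) (members T) (distinct T)
                   (∉-members-equal T closed (≤-reflexive H≡2) C∈T x∈C)
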